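{- Let $F$ be an isonemal fabric whose stripes (single strands for thin striping, adjacent pairs for thick striping) are coloured with a finite number of colours. If this colouring is perfect, then either the set of colours of the warps equals the set of colours of the wefts, or no colour is shared by a warp and a weft.
   Context: Cells are unit squares tessellating the plane; vertical strips are warps, horizontal strips are wefts. A prefabric assigns to each cell which crossing strand is on top; a fabric does not fall apart. With $\tau$ reflection in the plane of the fabric, the symmetry group $G_1$ consists of pairs $(t,r)$, $t$ a plane isometry preserving the cell tessellation and $r\in\{e,\tau\}$, with $t$ mapping the over/under relation to itself ($r=e$) or its reverse ($r=\tau$). Isonemal: periodic with $G_1$ transitive on all strands. Thin striping colours each strand; thick striping colours adjacent pairs of strands $[2a,2a+2]$. An element $(t,r)\in G_1$ is a colour symmetry if for each colour, $t$ maps all strands of that colour onto strands of one common colour; the colouring is perfect if every element of $G_1$ is a colour symmetry. -}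

module Defs where

open import Data.Bool using (Bool; true; false; if_then_else_; not; _xor_)
open import Data.Integer using (ℤ; -_; _+_; _*_; +_; _-_)
open import Data.Nat using (ℕ)
open import Data.Fin using (Fin)
open import Data.Product using (Σ; ∃; _×_; _,_)
open import Relation.Binary.PropositionalEquality using (_≡_; _≢_)
open import Relation.Nullary using (¬_)
open import Function.Bundles using (_⇔_)

-- Cells: the unit square [i,i+1]×[j,j+1] is indexed by (i , j) ∈ ℤ × ℤ.
-- Warp i is the vertical strip [i,i+1]×ℝ; weft j is the horizontal strip ℝ×[j,j+1].
-- Cell (i , j) is the crossing of warp i and weft j.

data Strand : Set where
  warp : ℤ → Strand
  weft : ℤ → Strand

-- A prefabric: at cell (i , j), value true means the warp is on top,
-- false means the weft is on top.
Prefabric : Set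
Prefabric = ℤ → ℤ → Bool

top : Prefabric → ℤ → ℤ → Strand
top F i j = if F i j then warp i else weft j

FallsApart : Prefabric → Set
FallsApart F =
  Σ (Strand → Bool) λ P →
    (∃ λ s → P s ≡ true) × (∃ λ s → P s ≡ false) ×
    (∀ i j → P (warp i) ≢ P (weft j) → P (top F i j) ≡ true)

IsFabric : Prefabric → Set
IsFabric F = ¬ FallsApart F

-- Isometries of the plane preserving the cell tessellation, acting on cell
-- indices.  Such an isometry is x ↦ A x + v with A in the dihedral group of
-- order 8 (signed permutation matrices); on cell indices it becomes
--   no swap : (i , j) ↦ (±i + b₁ , ±j + b₂)
--   swap    : (i , j) ↦ (±j + b₁ , ±i + b₂)
-- with b₁ b₂ ∈ ℤ; every such map arises.
record CellIso : Set where
  constructor mkIso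
  field
    swap : Bool
    neg₁ : Bool
    neg₂ : Bool
    b₁   : ℤ
    b₂   : ℤ

sgn : Bool → ℤ → ℤ
sgn n x = if n then - x else x

cellMap : CellIso → ℤ × ℤ → ℤ × ℤ
cellMap (mkIso false n₁ n₂ b₁ b₂) (i , j) = (sgn n₁ i + b₁ , sgn n₂ j + b₂)
cellMap (mkIso true  n₁ n₂ b₁ b₂) (i , j) = (sgn n₁ j + b₁ , sgn n₂ i + b₂)

strandMap : CellIso → Strand → Strand
strandMap (mkIso false n₁ n₂ b₁ b₂) (warp i) = warp (sgn n₁ i + b₁)
strandMap (mkIso false n₁ n₂ b₁ b₂) (weft j) = weft (sgn n₂ j + b₂)
strandMap (mkIso true  n₁ n₂ b₁ b₂) (warp i) = weft (sgn n₂ i + b₂)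
strandMap (mkIso true  n₁ n₂ b₁ b₂) (weft j) = warp (sgn n₁ j + b₁)

-- r ∈ {e, τ}: false = e (identity), true = τ (reflection in the plane of the fabric).
Sym : Set
Sym = CellIso × Bool

-- (t , r) ∈ G₁ : t maps the over/under relation to itself (r = e) or to its
-- reverse (r = τ).  Concretely: at the image cell, the strand on top is the image
-- of the strand on top at the original cell (r = e), resp. the image of the
-- strand underneath (r = τ).
InG₁ : Prefabric → Sym → Set
InG₁ F (t , r) = ∀ i j →
  let c = cellMap t (i , j)
      open Data.Product
  in F (proj₁ c) (proj₂ c) ≡ (F i j xor CellIso.swap t) xor r
  where import Data.Product

Periodic : Prefabric → Set
Periodic F =
  Σ (ℤ × ℤ) λ u → Σ (ℤ × ℤ) λ v →
    let open Data.Product in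
    (proj₁ u * proj₂ v - proj₂ u * proj₁ v ≢ + 0) ×
    InG₁ F (mkIso false false false (proj₁ u) (proj₂ u) , false) ×
    InG₁ F (mkIso false false false (proj₁ v) (proj₂ v) , false)
  where import Data.Product

Isonemal : Prefabric → Set
Isonemal F = Periodic F ×
  (∀ s s′ → Σ Sym λ g → InG₁ F g × (strandMap (Data.Product.proj₁ g) s ≡ s′))
  where import Data.Product

Colouring : ℕ → Set
Colouring k = Strand → Fin k

data Striping : Set where
  thin  : Striping
  thick : Striping

ValidStriping : ∀ {k} → Striping → Colouring k → Set
ValidStriping thin  col = Data.Unit.⊤
  where import Data.Unit
ValidStriping thick col =
  (∀ (a : ℤ) → col (warp ((+ 2) * a)) ≡ col (warp ((+ 2) * a + (+ 1)))) ×
  (∀ (a : ℤ) → col (weft ((+ 2) * a)) ≡ col (weft ((+ 2) * a + (+ 1))))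

ColourSymmetry : ∀ {k} → Colouring k → Sym → Set
ColourSymmetry {k} col (t , r) =
  ∀ (κ : Fin k) → Σ (Fin k) λ κ′ → ∀ s → col s ≡ κ → col (strandMap t s) ≡ κ′

Perfect : ∀ {k} → Prefabric → Colouring k → Set
Perfect F col = ∀ g → InG₁ F g → ColourSymmetry col g

WarpColour WeftColour : ∀ {k} → Colouring k → Fin k → Set
WarpColour col κ = ∃ λ i → col (warp i) ≡ κ
WeftColour col κ = ∃ λ j → col (weft j) ≡ κ

-- An element of G₁ that carries some weft to a warp interchanges warps and wefts.  So,
-- by transitivity, one coincidence between a warp colour and a weft colour is carried
-- to every warp and every weft, and the two palettes agree.  Constructively one must
-- also decide whether such a coincidence exists: a vertical period shifts the weft
-- colours by a self-map θ of the finite palette, the iterates of θ return to earlier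
-- values within k steps, and so every weft colour already occurs in a bounded window
-- of wefts.
module Submission where

open import Defs
open import Data.Nat using (ℕ)
open import Data.Fin using (Fin)
open import Data.Product using (_×_; ∃; _,_)
open import Data.Sum using (_⊎_)
open import Relation.Nullary using (¬_)
open import Relation.Binary.PropositionalEquality using (_≡_)
open import Function.Bundles using (_⇔_)

open import Data.Bool using (true; false; _xor_)
open import Data.Bool.Properties using (xor-identityʳ)
open import Data.Empty using (⊥-elim)
open import Data.Fin using (toℕ; fromℕ<)
open import Data.Fin.Properties
  using (any?; nonZeroIndex; pigeonhole; toℕ-fromℕ<; toℕ-mono-<; toℕ≤pred[n])
  renaming (_≟_ to _≟ᶠ_)
open import Data.Integer using (ℤ; +_; -[1+_]; +[1+_]; -_)
  renaming (_+_ to _+ℤ_; _*_ to _*ℤ_; _-_ to _-ℤ_)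
import Data.Integer.Properties as ℤ
open import Algebra.Properties.AbelianGroup ℤ.+-0-abelianGroup using (//-rightDividesˡ)
open import Data.Nat using (zero; suc; >-nonZero⁻¹; _+_; _*_; _∸_; _<_; _≤_; NonZero)
open import Data.Nat.DivMod using (_%_; _/_; m≡m%n+[m/n]*n; m%n<n)
open import Data.Nat.GeneralisedArithmetic using (fold; fold-+)
open import Data.Nat.Properties
  using ( +-commutativeSemigroup; +-identityʳ; +-suc; m≤n⇒m<n∨m≡n; m∸n+n≡m; n<1+n
        ; +-monoˡ-<; +-monoʳ-<; *-monoˡ-≤; ≤-trans)
open import Algebra.Properties.CommutativeSemigroup +-commutativeSemigroup using (x∙yz≈xz∙y)
open import Data.Product using (Σ; proj₁; proj₂)
open import Data.Sum using (inj₁; inj₂)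
open import Function.Bundles using (mk⇔; Equivalence)
open import Relation.Binary.PropositionalEquality
  using (_≢_; refl; sym; trans; cong; cong₂; subst; module ≡-Reasoning)
open import Relation.Nullary using (Dec; yes; no)

open ≡-Reasoning

fold-pigeonhole : ∀ {k} (f : Fin k → Fin k) x → ∃ λ m → m < k × fold x f k ≡ fold x f m
fold-pigeonhole {k} f x with pigeonhole (n<1+n k) (λ i → fold x f (toℕ i))
... | i , j , i<j , fⁱ≡fʲ = k ∸ toℕ j + toℕ i , shorter , revisit
  where
  j≤k : toℕ j ≤ k
  j≤k = toℕ≤pred[n] j

  shorter : k ∸ toℕ j + toℕ i < k
  shorter = subst (k ∸ toℕ j + toℕ i <_) (m∸n+n≡m j≤k) (+-monoʳ-< (k ∸ toℕ j) (toℕ-mono-< i<j))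

  revisit : fold x f k ≡ fold x f (k ∸ toℕ j + toℕ i)
  revisit = begin
    fold x f k                             ≡⟨ cong (fold x f) (m∸n+n≡m j≤k) ⟨
    fold x f (k ∸ toℕ j + toℕ j)           ≡⟨ fold-+ x f (k ∸ toℕ j) ⟩
    fold (fold x f (toℕ j)) f (k ∸ toℕ j)  ≡⟨ cong (λ y → fold y f (k ∸ toℕ j)) fⁱ≡fʲ ⟨
    fold (fold x f (toℕ i)) f (k ∸ toℕ j)  ≡⟨ fold-+ x f (k ∸ toℕ j) ⟨
    fold x f (k ∸ toℕ j + toℕ i)           ∎

fold-bounded : ∀ {k} (f : Fin k → Fin k) x n → ∃ λ m → m < k × fold x f n ≡ fold x f m
fold-bounded {k} f x zero = 0 , >-nonZero⁻¹ k {{nonZeroIndex x}} , refl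
fold-bounded {k} f x (suc n) with fold-bounded f x n
... | m , m<k , fⁿ≡fᵐ with m≤n⇒m<n∨m≡n m<k
...   | inj₁ 1+m<k = suc m , 1+m<k , cong f fⁿ≡fᵐ
...   | inj₂ refl with fold-pigeonhole f x
...     | m′ , m′<k , fᵏ≡fᵐ′ = m′ , m′<k , trans (cong f fⁿ≡fᵐ) fᵏ≡fᵐ′

module ShiftedSequence {k} (s : ℕ → Fin k) (d : ℕ) .{{_ : NonZero d}} (θ : Fin k → Fin k)
                       (s-shift : ∀ n → s (n + d) ≡ θ (s n)) where

  s-+* : ∀ r q → s (r + q * d) ≡ fold (s r) θ q
  s-+* r zero = cong s (+-identityʳ r)
  s-+* r (suc q) = begin
    s (r + (d + q * d))  ≡⟨ cong s (x∙yz≈xz∙y r d (q * d)) ⟩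
    s (r + q * d + d)    ≡⟨ s-shift (r + q * d) ⟩
    θ (s (r + q * d))    ≡⟨ cong θ (s-+* r q) ⟩
    θ (fold (s r) θ q)   ∎

  value-in-window : ∀ n → ∃ λ m → m < k * d × s m ≡ s n
  value-in-window n with fold-bounded θ (s (n % d)) (n / d)
  ... | m , m<k , fᵠ≡fᵐ = n % d + m * d , in-window , same-value
    where
    in-window : n % d + m * d < k * d
    in-window = ≤-trans (+-monoˡ-< (m * d) (m%n<n n d)) (*-monoˡ-≤ d m<k)

    same-value : s (n % d + m * d) ≡ s n
    same-value = begin
      s (n % d + m * d)          ≡⟨ s-+* (n % d) m ⟩
      fold (s (n % d)) θ m       ≡⟨ fᵠ≡fᵐ ⟨
      fold (s (n % d)) θ (n / d) ≡⟨ s-+* (n % d) (n / d) ⟨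
      s (n % d + n / d * d)      ≡⟨ cong s (m≡m%n+[m/n]*n n d) ⟨
      s n                        ∎

  value? : ∀ κ → Dec (∃ λ n → s n ≡ κ)
  value? κ with any? (λ (i : Fin (k * d)) → s (toℕ i) ≟ᶠ κ)
  ... | yes (i , sᵢ≡κ) = yes (toℕ i , sᵢ≡κ)
  ... | no ¬window = no λ (n , sₙ≡κ) →
    let m , m<kd , sₘ≡sₙ = value-in-window n
    in ¬window (fromℕ< m<kd , trans (cong s (toℕ-fromℕ< m<kd)) (trans sₘ≡sₙ sₙ≡κ))

∃ℤ? : ∀ {P : ℤ → Set} → Dec (∃ λ n → P (+ n)) → Dec (∃ λ n → P -[1+ n ]) → Dec (∃ P)
∃ℤ? (yes (n , p)) _             = yes (+ n , p)
∃ℤ? (no _)        (yes (n , p)) = yes (-[1+ n ] , p)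
∃ℤ? (no ¬⁺)       (no ¬⁻)       = no λ { (+ n , p) → ¬⁺ (n , p) ; (-[1+ n ] , p) → ¬⁻ (n , p) }

ℤ-value? : ∀ {k} (c : ℤ → Fin k) B (θ⁺ θ⁻ : Fin k → Fin k) →
           (∀ j → c (j +ℤ + suc B) ≡ θ⁺ (c j)) → (∀ j → c (j +ℤ -[1+ B ]) ≡ θ⁻ (c j)) →
           ∀ κ → Dec (∃ λ j → c j ≡ κ)
ℤ-value? c B θ⁺ θ⁻ up down κ = ∃ℤ? (Up.value? κ) (Down.value? κ)
  where
  module Up   = ShiftedSequence (λ n → c (+ n)) (suc B) θ⁺ (λ n → up (+ n))
  module Down = ShiftedSequence (λ n → c -[1+ n ]) (suc B) θ⁻
                  (λ n → trans (cong (λ m → c -[1+ m ]) (+-suc n B)) (down -[1+ n ]))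

module PerfectColouring {F k} {col : Colouring k} (perfect : Perfect F col) where

  recolour : ∀ g → InG₁ F g → Fin k → Fin k
  recolour g g∈G₁ κ = proj₁ (perfect g g∈G₁ κ)

  col-strandMap : ∀ g (g∈G₁ : InG₁ F g) s →
                  col (strandMap (proj₁ g) s) ≡ recolour g g∈G₁ (col s)
  col-strandMap g g∈G₁ s = proj₂ (perfect g g∈G₁ (col s)) s refl

  strandMap-preserves-sameColour : ∀ g → InG₁ F g → ∀ {s s′} → col s ≡ col s′ →
                                   col (strandMap (proj₁ g) s) ≡ col (strandMap (proj₁ g) s′)
  strandMap-preserves-sameColour g g∈G₁ {s} {s′} same = begin
    col (strandMap (proj₁ g) s)   ≡⟨ col-strandMap g g∈G₁ s ⟩
    recolour g g∈G₁ (col s)       ≡⟨ cong (recolour g g∈G₁) same ⟩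
    recolour g g∈G₁ (col s′)      ≡⟨ col-strandMap g g∈G₁ s′ ⟨
    col (strandMap (proj₁ g) s′)  ∎

weft↦warp⇒warp↦weft : ∀ t {j i} a → strandMap t (weft j) ≡ warp i →
                      ∃ λ j′ → strandMap t (warp a) ≡ weft j′
weft↦warp⇒warp↦weft (mkIso true n₁ n₂ b₁ b₂) a _ = sgn n₂ a +ℤ b₂ , refl

warp↦weft⇒weft↦warp : ∀ t {i j} b → strandMap t (warp i) ≡ weft j →
                      ∃ λ i′ → strandMap t (weft b) ≡ warp i′
warp↦weft⇒weft↦warp (mkIso true n₁ n₂ b₁ b₂) b _ = sgn n₁ b +ℤ b₁ , refl

StrandTransitive : Prefabric → Set
StrandTransitive F = ∀ s s′ → Σ Sym λ g → InG₁ F g × (strandMap (proj₁ g) s ≡ s′)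

sharedColour⇒samePalette : ∀ F {k} {col : Colouring k} → StrandTransitive F → Perfect F col →
                           ∀ {a b} → col (warp a) ≡ col (weft b) →
                           ∀ κ → WarpColour col κ ⇔ WeftColour col κ
sharedColour⇒samePalette F {col = col} transitive perfect {a} {b} shared κ = mk⇔ toWeft toWarp
  where
  open PerfectColouring {F} {col = col} perfect

  toWeft : WarpColour col κ → WeftColour col κ
  toWeft (i , colᵢ≡κ) with transitive (weft b) (warp i)
  ... | g@(t , _) , g∈G₁ , b↦i with weft↦warp⇒warp↦weft t a b↦i
  ...   | j , a↦j = j , (begin
    col (weft j)               ≡⟨ cong col a↦j ⟨
    col (strandMap t (warp a)) ≡⟨ strandMap-preserves-sameColour g g∈G₁ shared ⟩
    col (strandMap t (weft b)) ≡⟨ cong col b↦i ⟩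
    col (warp i)               ≡⟨ colᵢ≡κ ⟩
    κ                          ∎)

  toWarp : WeftColour col κ → WarpColour col κ
  toWarp (j , colⱼ≡κ) with transitive (warp a) (weft j)
  ... | g@(t , _) , g∈G₁ , a↦j with warp↦weft⇒weft↦warp t b a↦j
  ...   | i , b↦i = i , (begin
    col (warp i)               ≡⟨ cong col b↦i ⟨
    col (strandMap t (weft b)) ≡⟨ strandMap-preserves-sameColour g g∈G₁ (sym shared) ⟩
    col (strandMap t (warp a)) ≡⟨ cong col a↦j ⟩
    col (weft j)               ≡⟨ colⱼ≡κ ⟩
    κ                          ∎)

translation : ℤ → ℤ → CellIso
translation = mkIso false false false

translation-inverse : ∀ F {a b} → InG₁ F (translation a b , false) →
                      InG₁ F (translation (- a) (- b) , false)
translation-inverse F {a} {b} invariant i j = begin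
  F (i -ℤ a) (j -ℤ b)                        ≡⟨ xor-false² _ ⟨
  (F (i -ℤ a) (j -ℤ b) xor false) xor false  ≡⟨ invariant (i -ℤ a) (j -ℤ b) ⟨
  F (i -ℤ a +ℤ a) (j -ℤ b +ℤ b)              ≡⟨ cong₂ F (//-rightDividesˡ a i) (//-rightDividesˡ b j) ⟩
  F i j                                      ≡⟨ xor-false² _ ⟨
  (F i j xor false) xor false                ∎
  where
  xor-false² : ∀ x → (x xor false) xor false ≡ x
  xor-false² x = trans (xor-identityʳ (x xor false)) (xor-identityʳ x)

VerticalPeriod : Prefabric → ℕ → Set
VerticalPeriod F B = (∃ λ a → InG₁ F (translation a (+ suc B) , false))
                   × (∃ λ a → InG₁ F (translation a -[1+ B ] , false))

translation⇒verticalPeriod : ∀ F {a b} → InG₁ F (translation a b , false) → b ≢ + 0 →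
                             ∃ (VerticalPeriod F)
translation⇒verticalPeriod F {b = + zero} _ b≢0 = ⊥-elim (b≢0 refl)
translation⇒verticalPeriod F {a} {b = +[1+ B ]} T _ = B , (a , T) , (- a , translation-inverse F T)
translation⇒verticalPeriod F {a} {b = -[1+ B ]} T _ = B , (- a , translation-inverse F T) , (a , T)

periodic⇒verticalPeriod : ∀ F → Periodic F → ∃ (VerticalPeriod F)
periodic⇒verticalPeriod F ((u₁ , u₂) , (v₁ , v₂) , det≢0 , Tu , Tv) with u₂ ℤ.≟ + 0
... | no u₂≢0 = translation⇒verticalPeriod F Tu u₂≢0
... | yes refl = translation⇒verticalPeriod F Tv λ where
  refl → det≢0 (cong (_-ℤ + 0 *ℤ v₁) (ℤ.*-zeroʳ u₁))

weftColour? : ∀ F {k} {col : Colouring k} → Periodic F → Perfect F col →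
              ∀ κ → Dec (WeftColour col κ)
weftColour? F {col = col} periodic perfect with periodic⇒verticalPeriod F periodic
... | B , (a , up) , (a′ , down) =
  ℤ-value? (λ j → col (weft j)) B (recolour g⁺ up) (recolour g⁻ down)
           (λ j → col-strandMap g⁺ up (weft j)) (λ j → col-strandMap g⁻ down (weft j))
  where
  open PerfectColouring {F} {col = col} perfect

  g⁺ g⁻ : Sym
  g⁺ = translation a (+ suc B) , false
  g⁻ = translation a′ -[1+ B ] , false

lemma5 : (F : Prefabric) → IsFabric F → Isonemal F →
         (σ : Striping) (k : ℕ) (col : Colouring k) → ValidStriping σ col →
         Perfect F col →
         (∀ κ → WarpColour col κ ⇔ WeftColour col κ)
         ⊎ (¬ ∃ λ i → ∃ λ j → col (warp i) ≡ col (weft j))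
lemma5 F _ (periodic , transitive) _ k col _ perfect
  with weftColour? F periodic perfect (col (warp (+ 0)))
... | yes (_ , shared) = inj₁ (sharedColour⇒samePalette F transitive perfect (sym shared))
... | no ¬shared = inj₂ λ (_ , _ , shared) →
  let palettes = sharedColour⇒samePalette F transitive perfect shared (col (warp (+ 0)))
  in ¬shared (Equivalence.to palettes (+ 0 , refl))
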